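{- Let $P$ be a $DUU$-avoiding Dyck path with associated composition $\mathbf{c}=(c_1,\dots,c_h)$. Then $F(P)$ is the $DUU$-avoiding Dyck path whose associated composition is obtained from $\mathbf{c}$ as follows: number the entries from the end (so $c_h$ is in position $1$, $c_{h-1}$ in position $2$, etc.); simultaneously, each entry $c$ in an even position is replaced by $c-1$ entries equal to $1$ and its left neighbor is increased by $1$, where if the first entry $c_1$ is in an even position (i.e. $h$ is even) its left neighbor is taken to be an implicit entry $0$, which thus becomes an entry $1$. For example $(4,2,1,5,2,3)\mapsto(1,1,1,1,3,6,1,3)$.
   Context: Dyck paths are words in $U$ (upstep) and $D$ (downstep) with equally many of each such that every prefix has at least as many $U$'s as $D$'s; size = number of $U$'s; $\epsilon$ = empty path; powers denote repetition. A nonempty Dyck path is primitive if no nonempty proper prefix is a Dyck path; every nonempty Dyck path is uniquely a concatenation of primitive ones (its components). The bijection $F$ on Dyck paths: $F(\epsilon)=\epsilon$; if $P$ has components $P_1,\dots,P_r$, $r\ge2$, then $F(P)=F(P_1)\cdots F(P_r)$; a primitive $P$ is uniquely $P=UQ(UD)^iD$ with $i\ge0$ and $Q$ a Dyck path that is empty or ends with $DD$, and $F(P)=U^{i+1}F(R)UDD^{i+1}$ if $Q$ is primitive, $Q=URD$, while $F(P)=U^{i+1}F(Q)D^{i+1}$ if $Q$ is not primitive (including $Q=\epsilon$). The height of a vertex is its height above the starting level, the height of a path the maximum vertex height. A Dyck path avoids $DUU$ if it has no three consecutive steps $D,U,U$. To a $DUU$-avoiding Dyck $n$-path of height $h$ associate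 the composition $(c_1,\dots,c_h)$ of $n$ where $c_i$ is the number of downsteps ending at height $h-i$; this is a bijection between $DUU$-avoiding Dyck $n$-paths and compositions of $n$. -}

module Defs where

open import Data.Bool using (Bool; true; false; if_then_else_)
open import Data.Nat using (ℕ; zero; suc; _+_; _∸_; _⊔_)
open import Data.Nat.Properties using (_≟_)
open import Data.List using (List; []; _∷_; _++_; reverse; replicate; length; filter; applyUpTo; foldr)
open import Data.Product using (_×_; _,_; proj₁; proj₂)
open import Relation.Binary.PropositionalEquality using (_≡_)
open import Relation.Nullary using (¬_)

data Step : Set where
  U D : Step

Path : Set
Path = List Step

data DyckFrom : ℕ → Path → Set where
  done : DyckFrom 0 []
  up   : ∀ {h xs} → DyckFrom (suc h) xs → DyckFrom h (U ∷ xs)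
  down : ∀ {h xs} → DyckFrom h xs → DyckFrom (suc h) (D ∷ xs)

IsDyck : Path → Set
IsDyck P = DyckFrom 0 P

AvoidsDUU : Path → Set
AvoidsDUU P = ∀ (xs ys : Path) → ¬ (P ≡ xs ++ D ∷ U ∷ U ∷ ys)

-- compGo h xs (h = current height, ≥ 0): returns the steps up to and
-- including the first return to height 0, and the remaining steps.
compGo : ℕ → Path → Path × Path
compGo zero xs = [] , xs
compGo (suc h) [] = [] , []
compGo (suc h) (U ∷ xs) with compGo (suc (suc h)) xs
... | a , b = U ∷ a , b
compGo (suc h) (D ∷ xs) with compGo h xs
... | a , b = D ∷ a , b

-- For a nonempty Dyck path: (first component , remaining components).
splitComp : Path → Path × Path
splitComp [] = [] , []
splitComp (U ∷ xs) with compGo 1 xs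
... | a , b = U ∷ a , b
splitComp (D ∷ xs) = D ∷ [] , xs   -- never happens for Dyck paths

isPrimitive : Path → Bool
isPrimitive [] = false
isPrimitive (s ∷ xs) with proj₂ (splitComp (s ∷ xs))
... | [] = true
... | _ ∷ _ = false

dropLast : Path → Path
dropLast xs with reverse xs
... | [] = []
... | _ ∷ ys = reverse ys

inner : Path → Path
inner [] = []
inner (_ ∷ xs) = dropLast xs

-- on a reversed path, strip the maximal number of (reversed) trailing U D
stripRev : Path → ℕ × Path
stripRev (D ∷ U ∷ ys) with stripRev ys
... | i , q = suc i , q
stripRev ys = 0 , ys

-- X = Q (UD)^i with i maximal (so Q is empty or ends with DD
-- when X is Dyck); returns (i , Q)
stripUD : Path → ℕ × Path
stripUD X with stripRev (reverse X)
... | i , q = i , reverse q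

-- F on a primitive path P = U Q (UD)^i D, given F for shorter paths.
Fprim : (Path → Path) → Path → Path
Fprim F P with stripUD (inner P)
... | i , Q =
  if isPrimitive Q
  then replicate (suc i) U ++ F (inner Q) ++ U ∷ D ∷ replicate (suc i) D
  else replicate (suc i) U ++ F Q ++ replicate (suc i) D

-- F with fuel: F applied to each component.  Fuel ≥ length suffices,
-- since every recursive call is on a strictly shorter path.
Ffuel : ℕ → Path → Path
Ffuel zero _ = []
Ffuel (suc n) [] = []
Ffuel (suc n) (s ∷ xs) with splitComp (s ∷ xs)
... | p , rest = Fprim (Ffuel n) p ++ Ffuel n rest

F : Path → Path
F P = Ffuel (length P) P

vertexHeights : ℕ → Path → List ℕ
vertexHeights h [] = h ∷ []
vertexHeights h (U ∷ xs) = h ∷ vertexHeights (suc h) xs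
vertexHeights h (D ∷ xs) = h ∷ vertexHeights (h ∸ 1) xs

height : Path → ℕ
height P = foldr _⊔_ 0 (vertexHeights 0 P)

downEnds : ℕ → Path → List ℕ
downEnds h [] = []
downEnds h (U ∷ xs) = downEnds (suc h) xs
downEnds h (D ∷ xs) = (h ∸ 1) ∷ downEnds (h ∸ 1) xs

downstepsEndingAt : Path → ℕ → ℕ
downstepsEndingAt P j = length (filter (_≟ j) (downEnds 0 P))

composition : Path → List ℕ
composition P = applyUpTo (λ k → downstepsEndingAt P (height P ∸ suc k)) (height P)

-- Acting on the REVERSED composition (position 1 first):
-- odd positions are kept, each entry c in an even position becomes
-- c − 1 ones, and the following (= left neighbour, an odd position) entry
-- is increased by 1; if there is no such entry, an implicit 0 becomes 1.
-- trOdd k : next entry is in an odd position and receives the increment k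
-- (k = 1 iff the preceding entry was in an even position).
mutual
  trOdd : ℕ → List ℕ → List ℕ
  trOdd zero [] = []
  trOdd (suc k) [] = suc k ∷ []      -- implicit entry 0 increased
  trOdd k (x ∷ rest) = (k + x) ∷ trEven rest

  trEven : List ℕ → List ℕ
  trEven [] = []
  trEven (y ∷ rest) = replicate (y ∸ 1) 1 ++ trOdd 1 rest

transformComposition : List ℕ → List ℕ
transformComposition c = reverse (trOdd 0 (reverse c))

-- Encode a DUU-avoiding Dyck path by its composition with every entry decreased by
-- one.  Read top-down the path is U^h D (UD)^(c₁−1) ⋯ D (UD)^(c_h−1); read bottom-up
-- it is U P′ D (UD)^(c_h−1) with P′ the path of (c₁, …, c_{h−1}).  Its components are
-- U P′ D and c_h − 1 peaks UD, which F fixes, so c_h is kept.  Write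
-- P′ = U P″ D (UD)^(c_{h−1}−1).  If P″ is nonempty, U P′ D = U Q (UD)^i D with
-- Q = U P″ D primitive, so F maps it to U^(c_{h−1}) F(P″) UD D^(c_{h−1}): besides the
-- level enclosing the component, the nesting gives c_{h−1} − 1 entries 1, and the
-- peak UD adds one to the last entry of F(P″), namely to c_{h−2}, which F transforms
-- in the same way.  If P″ is empty, Q = ε and F(U P′ D) = U^(c_{h−1}+1) D^(c_{h−1}+1)
-- has c_{h−1} − 1 entries 1 plus the implicit entry 1.
module Submission where

open import Defs
open import Data.Bool using (true; false; if_then_else_)
open import Data.Empty using (⊥-elim)
open import Data.List
open import Data.List.Properties
open import Data.List.Relation.Unary.All.Properties using (replicate⁺)
open import Data.Nat
open import Data.Nat.Properties
open import Data.Product using (∃; ∃₂; _×_; _,_; proj₁; proj₂)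
open import Data.Sum using (_⊎_; inj₁; inj₂)
open import Function using (_∘_)
open import Relation.Binary.PropositionalEquality
open ≡-Reasoning

replicate-∷ʳ : ∀ {A : Set} n (x : A) → replicate n x ∷ʳ x ≡ x ∷ replicate n x
replicate-∷ʳ zero    x = refl
replicate-∷ʳ (suc n) x = cong (x ∷_) (replicate-∷ʳ n x)

applyUpTo-cong : ∀ {A : Set} n {f g : ℕ → A} →
  (∀ k → k < n → f k ≡ g k) → applyUpTo f n ≡ applyUpTo g n
applyUpTo-cong zero    f≗g = refl
applyUpTo-cong (suc n) f≗g =
  cong₂ _∷_ (f≗g 0 z<s) (applyUpTo-cong n (λ k k<n → f≗g (suc k) (s<s k<n)))

peaks : ℕ → Path
peaks zero    = []
peaks (suc m) = U ∷ D ∷ peaks m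

lift : Path → Path
lift X = U ∷ X ++ D ∷ []

nest : ℕ → Path → Path
nest k X = replicate k U ++ X ++ replicate k D

-- pathOf c is the DUU-avoiding path with composition map suc c, and pathʳ ms the
-- one with composition reverse (map suc ms).
descent : List ℕ → Path
descent []      = []
descent (m ∷ c) = D ∷ peaks m ++ descent c

pathOf : List ℕ → Path
pathOf c = replicate (length c) U ++ descent c

pathʳ : List ℕ → Path
pathʳ []       = []
pathʳ (m ∷ ms) = lift (pathʳ ms) ++ peaks m

peaks-suc-∷ʳ : ∀ m → peaks (suc m) ≡ peaks m ++ U ∷ D ∷ []
peaks-suc-∷ʳ zero    = refl
peaks-suc-∷ʳ (suc m) = cong (λ P → U ∷ D ∷ P) (peaks-suc-∷ʳ m)

pathOf-∷ʳ : ∀ c m → pathOf (c ∷ʳ m) ≡ lift (pathOf c) ++ peaks m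
pathOf-∷ʳ c m = begin
    replicate (length (c ∷ʳ m)) U ++ descent (c ∷ʳ m)
  ≡⟨ cong₂ (λ h P → replicate h U ++ P) (length-∷ʳ c m) (descent-∷ʳ c) ⟩
    U ∷ replicate (length c) U ++ descent c ++ D ∷ peaks m
  ≡⟨ cong (U ∷_) (sym (++-assoc (replicate (length c) U) (descent c) _)) ⟩
    U ∷ pathOf c ++ D ∷ peaks m
  ≡⟨ cong (U ∷_) (sym (++-assoc (pathOf c) (D ∷ []) (peaks m))) ⟩
    lift (pathOf c) ++ peaks m ∎
  where
  length-∷ʳ : ∀ (c : List ℕ) m → length (c ∷ʳ m) ≡ suc (length c)
  length-∷ʳ c m = trans (length-++ c) (+-comm (length c) 1)
  descent-∷ʳ : ∀ c → descent (c ∷ʳ m) ≡ descent c ++ D ∷ peaks m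
  descent-∷ʳ []      = cong (λ P → D ∷ P) (++-identityʳ (peaks m))
  descent-∷ʳ (k ∷ c) = cong (D ∷_) (trans (cong (peaks k ++_) (descent-∷ʳ c))
                                          (sym (++-assoc (peaks k) (descent c) _)))

pathʳ≡pathOf-reverse : ∀ ms → pathʳ ms ≡ pathOf (reverse ms)
pathʳ≡pathOf-reverse []       = refl
pathʳ≡pathOf-reverse (m ∷ ms) = begin
    lift (pathʳ ms) ++ peaks m
  ≡⟨ cong (λ P → lift P ++ peaks m) (pathʳ≡pathOf-reverse ms) ⟩
    lift (pathOf (reverse ms)) ++ peaks m
  ≡⟨ sym (pathOf-∷ʳ (reverse ms) m) ⟩
    pathOf (reverse ms ∷ʳ m)
  ≡⟨ cong pathOf (sym (unfold-reverse m ms)) ⟩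
    pathOf (reverse (m ∷ ms)) ∎

pathOf≡pathʳ-reverse : ∀ c → pathOf c ≡ pathʳ (reverse c)
pathOf≡pathʳ-reverse c =
  trans (cong pathOf (sym (reverse-involutive c))) (sym (pathʳ≡pathOf-reverse (reverse c)))

U^-dyck : ∀ n {k X} → DyckFrom (n + k) X → DyckFrom k (replicate n U ++ X)
U^-dyck zero        d = d
U^-dyck (suc n) {k} {X} d = up (U^-dyck n (subst (λ h → DyckFrom h X) (sym (+-suc n k)) d))

peaks-dyck : ∀ m {h Y} → DyckFrom h Y → DyckFrom h (peaks m ++ Y)
peaks-dyck zero    d = d
peaks-dyck (suc m) d = up (down (peaks-dyck m d))

descent-dyck : ∀ c → DyckFrom (length c) (descent c)
descent-dyck []      = done
descent-dyck (m ∷ c) = down (peaks-dyck m (descent-dyck c))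

pathOf-isDyck : ∀ c → IsDyck (pathOf c)
pathOf-isDyck c =
  U^-dyck (length c) (subst (λ h → DyckFrom h (descent c)) (sym (+-identityʳ _)) (descent-dyck c))

pathʳ-isDyck : ∀ ms → IsDyck (pathʳ ms)
pathʳ-isDyck ms = subst IsDyck (sym (pathʳ≡pathOf-reverse ms)) (pathOf-isDyck (reverse ms))

avoidsDUU-[] : AvoidsDUU []
avoidsDUU-[] []      ys ()
avoidsDUU-[] (_ ∷ _) ys ()

avoidsDUU-∷ : ∀ {x P} → (∀ ys → x ∷ P ≢ D ∷ U ∷ U ∷ ys) → AvoidsDUU P → AvoidsDUU (x ∷ P)
avoidsDUU-∷ ¬DUU avoids []       ys eq = ¬DUU ys eq
avoidsDUU-∷ ¬DUU avoids (_ ∷ xs) ys eq = avoids xs ys (∷-injectiveʳ eq)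

avoidsDUU-tail : ∀ {x P} → AvoidsDUU (x ∷ P) → AvoidsDUU P
avoidsDUU-tail {x} avoids xs ys eq = avoids (x ∷ xs) ys (cong (x ∷_) eq)

U^-avoidsDUU : ∀ n {X} → AvoidsDUU X → AvoidsDUU (replicate n U ++ X)
U^-avoidsDUU zero    avoids = avoids
U^-avoidsDUU (suc n) avoids = avoidsDUU-∷ (λ _ ()) (U^-avoidsDUU n avoids)

D-peaks-descent-avoidsDUU : ∀ m c → AvoidsDUU (D ∷ peaks m ++ descent c)
D-peaks-descent-avoidsDUU (suc m) c =
  avoidsDUU-∷ (λ _ ()) (avoidsDUU-∷ (λ _ ()) (D-peaks-descent-avoidsDUU m c))
D-peaks-descent-avoidsDUU zero []      = avoidsDUU-∷ (λ _ ()) avoidsDUU-[]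
D-peaks-descent-avoidsDUU zero (m ∷ c) = avoidsDUU-∷ (λ _ ()) (D-peaks-descent-avoidsDUU m c)

pathOf-avoidsDUU : ∀ c → AvoidsDUU (pathOf c)
pathOf-avoidsDUU []      = avoidsDUU-[]
pathOf-avoidsDUU (m ∷ c) = U^-avoidsDUU (length (m ∷ c)) (D-peaks-descent-avoidsDUU m c)

descent-view : ∀ {h Y} → DyckFrom h Y → AvoidsDUU (D ∷ Y) →
  ∃₂ λ m c → length c ≡ h × Y ≡ peaks m ++ descent c
descent-view done avoids = 0 , [] , refl , refl
descent-view (down d) avoids with descent-view d (avoidsDUU-tail avoids)
... | m , c , refl , refl = 0 , m ∷ c , refl , refl
descent-view (up (down d)) avoids with descent-view d (avoidsDUU-tail (avoidsDUU-tail avoids))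
... | m , c , refl , refl = suc m , c , refl , refl
descent-view (up (up d)) avoids = ⊥-elim (avoids [] _ refl)

U^-descent-view : ∀ {k P} → DyckFrom k P → AvoidsDUU P →
  ∃₂ λ n c → length c ≡ n + k × P ≡ replicate n U ++ descent c
U^-descent-view done avoids = 0 , [] , refl , refl
U^-descent-view {k} (up d) avoids with U^-descent-view d (avoidsDUU-tail avoids)
... | n , c , len , refl = suc n , c , trans len (+-suc n k) , refl
U^-descent-view (down d) avoids with descent-view d avoids
... | m , c , refl , refl = 0 , m ∷ c , refl , refl

dyck-avoidsDUU⇒pathOf : ∀ {P} → IsDyck P → AvoidsDUU P → ∃ λ c → P ≡ pathOf c
dyck-avoidsDUU⇒pathOf d avoids with U^-descent-view d avoids
... | n , c , len , refl =
  c , cong (λ k → replicate k U ++ descent c) (sym (trans len (+-identityʳ n)))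

maxHeight : ℕ → Path → ℕ
maxHeight h X = foldr _⊔_ 0 (vertexHeights h X)

start≤maxHeight : ∀ h X → h ≤ maxHeight h X
start≤maxHeight h []      = m≤m⊔n h 0
start≤maxHeight h (U ∷ X) = m≤m⊔n h _
start≤maxHeight h (D ∷ X) = m≤m⊔n h _

maxHeight-U^ : ∀ n k X → maxHeight k (replicate n U ++ X) ≡ maxHeight (n + k) X
maxHeight-U^ zero    k X = refl
maxHeight-U^ (suc n) k X = begin
    k ⊔ maxHeight (suc k) (replicate n U ++ X)
  ≡⟨ cong (k ⊔_) (maxHeight-U^ n (suc k) X) ⟩
    k ⊔ maxHeight (n + suc k) X
  ≡⟨ m≤n⇒m⊔n≡n (≤-trans (≤-trans (n≤1+n k) (m≤n+m (suc k) n)) (start≤maxHeight _ X)) ⟩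
    maxHeight (n + suc k) X
  ≡⟨ cong (λ h → maxHeight h X) (+-suc n k) ⟩
    maxHeight (suc n + k) X ∎

maxHeight-peaks : ∀ m L Y → maxHeight L Y ≤ suc L → maxHeight L (peaks m ++ Y) ≤ suc L
maxHeight-peaks zero    L Y bound = bound
maxHeight-peaks (suc m) L Y bound = ⊔-lub (n≤1+n L) (⊔-lub ≤-refl (maxHeight-peaks m L Y bound))

maxHeight-descent : ∀ c → maxHeight (length c) (descent c) ≡ length c
maxHeight-descent []      = refl
maxHeight-descent (m ∷ c) =
  m≥n⇒m⊔n≡m (maxHeight-peaks m _ _ (≤-trans (≤-reflexive (maxHeight-descent c)) (n≤1+n _)))

height-pathOf : ∀ c → height (pathOf c) ≡ length c
height-pathOf c = begin
    maxHeight 0 (replicate (length c) U ++ descent c)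
  ≡⟨ maxHeight-U^ (length c) 0 (descent c) ⟩
    maxHeight (length c + 0) (descent c)
  ≡⟨ cong (λ h → maxHeight h (descent c)) (+-identityʳ _) ⟩
    maxHeight (length c) (descent c)
  ≡⟨ maxHeight-descent c ⟩
    length c ∎

occurrences : ℕ → List ℕ → ℕ
occurrences j xs = length (filter (_≟ j) xs)

occurrences-++ : ∀ j xs ys → occurrences j (xs ++ ys) ≡ occurrences j xs + occurrences j ys
occurrences-++ j xs ys = trans (cong length (filter-++ (_≟ j) xs ys)) (length-++ (filter (_≟ j) xs))

occurrences-replicate : ∀ j n → occurrences j (replicate n j) ≡ n
occurrences-replicate j n =
  trans (cong length (filter-all (_≟ j) (replicate⁺ n refl))) (length-replicate n)

occurrences-replicate-≢ : ∀ {i j} n → i ≢ j → occurrences j (replicate n i) ≡ 0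
occurrences-replicate-≢ n i≢j = cong length (filter-none (_≟ _) (replicate⁺ n i≢j))

descentEnds : List ℕ → List ℕ
descentEnds []      = []
descentEnds (m ∷ c) = replicate (suc m) (length c) ++ descentEnds c

downEnds-U^ : ∀ n k X → downEnds k (replicate n U ++ X) ≡ downEnds (n + k) X
downEnds-U^ zero    k X = refl
downEnds-U^ (suc n) k X = trans (downEnds-U^ n (suc k) X) (cong (λ h → downEnds h X) (+-suc n k))

downEnds-peaks : ∀ m L Y → downEnds L (peaks m ++ Y) ≡ replicate m L ++ downEnds L Y
downEnds-peaks zero    L Y = refl
downEnds-peaks (suc m) L Y = cong (L ∷_) (downEnds-peaks m L Y)

downEnds-descent : ∀ c → downEnds (length c) (descent c) ≡ descentEnds c
downEnds-descent []      = refl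
downEnds-descent (m ∷ c) = cong (length c ∷_) (begin
    downEnds (length c) (peaks m ++ descent c)
  ≡⟨ downEnds-peaks m (length c) (descent c) ⟩
    replicate m (length c) ++ downEnds (length c) (descent c)
  ≡⟨ cong (replicate m (length c) ++_) (downEnds-descent c) ⟩
    replicate m (length c) ++ descentEnds c ∎)

downEnds-pathOf : ∀ c → downEnds 0 (pathOf c) ≡ descentEnds c
downEnds-pathOf c = begin
    downEnds 0 (replicate (length c) U ++ descent c)
  ≡⟨ downEnds-U^ (length c) 0 (descent c) ⟩
    downEnds (length c + 0) (descent c)
  ≡⟨ cong (λ h → downEnds h (descent c)) (+-identityʳ _) ⟩
    downEnds (length c) (descent c)
  ≡⟨ downEnds-descent c ⟩
    descentEnds c ∎

occurrences-descentEnds-≥ : ∀ j c → length c ≤ j → occurrences j (descentEnds c) ≡ 0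
occurrences-descentEnds-≥ j []      _     = refl
occurrences-descentEnds-≥ j (m ∷ c) len<j = begin
    occurrences j (replicate (suc m) (length c) ++ descentEnds c)
  ≡⟨ occurrences-++ j (replicate (suc m) (length c)) (descentEnds c) ⟩
    occurrences j (replicate (suc m) (length c)) + occurrences j (descentEnds c)
  ≡⟨ cong₂ _+_ (occurrences-replicate-≢ (suc m) (<⇒≢ len<j))
               (occurrences-descentEnds-≥ j c (<⇒≤ len<j)) ⟩
    0 ∎

composition-descentEnds : ∀ c →
  applyUpTo (λ k → occurrences (length c ∸ suc k) (descentEnds c)) (length c) ≡ map suc c
composition-descentEnds []      = refl
composition-descentEnds (m ∷ c) =
  cong₂ _∷_ top (trans (applyUpTo-cong L below) (composition-descentEnds c))
  where
  L = length c
  top : occurrences L (replicate (suc m) L ++ descentEnds c) ≡ suc m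
  top = begin
      occurrences L (replicate (suc m) L ++ descentEnds c)
    ≡⟨ occurrences-++ L (replicate (suc m) L) (descentEnds c) ⟩
      occurrences L (replicate (suc m) L) + occurrences L (descentEnds c)
    ≡⟨ cong₂ _+_ (occurrences-replicate L (suc m)) (occurrences-descentEnds-≥ L c ≤-refl) ⟩
      suc m + 0
    ≡⟨ +-identityʳ (suc m) ⟩
      suc m ∎
  below : ∀ k → k < L → occurrences (L ∸ suc k) (replicate (suc m) L ++ descentEnds c)
                      ≡ occurrences (L ∸ suc k) (descentEnds c)
  below k k<L = begin
      occurrences (L ∸ suc k) (replicate (suc m) L ++ descentEnds c)
    ≡⟨ occurrences-++ (L ∸ suc k) (replicate (suc m) L) (descentEnds c) ⟩
      occurrences (L ∸ suc k) (replicate (suc m) L) + occurrences (L ∸ suc k) (descentEnds c)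
    ≡⟨ cong (_+ occurrences (L ∸ suc k) (descentEnds c))
            (occurrences-replicate-≢ (suc m)
              (≢-sym (<⇒≢ (∸-monoʳ-< {L} {suc k} {0} z<s k<L)))) ⟩
      occurrences (L ∸ suc k) (descentEnds c) ∎

composition-pathOf : ∀ c → composition (pathOf c) ≡ map suc c
composition-pathOf c = begin
    composition (pathOf c)
  ≡⟨ cong₂ (λ h ends → applyUpTo (λ k → occurrences (h ∸ suc k) ends) h)
           (height-pathOf c) (downEnds-pathOf c) ⟩
    applyUpTo (λ k → occurrences (length c ∸ suc k) (descentEnds c)) (length c)
  ≡⟨ composition-descentEnds c ⟩
    map suc c ∎

compGo-++ : ∀ {j X} → DyckFrom j X → ∀ k Z →
  compGo (suc (j + k)) (X ++ Z) ≡ (X ++ proj₁ (compGo (suc k) Z) , proj₂ (compGo (suc k) Z))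
compGo-++ done     k Z = refl
compGo-++ (up d)   k Z rewrite compGo-++ d k Z = refl
compGo-++ (down d) k Z rewrite compGo-++ d k Z = refl

splitComp-lift : ∀ {X} → IsDyck X → ∀ Y → splitComp (lift X ++ Y) ≡ (lift X , Y)
splitComp-lift {X} d Y = cong (λ p → U ∷ proj₁ p , proj₂ p)
  (trans (cong (compGo 1) (++-assoc X (D ∷ []) Y)) (compGo-++ d 0 (D ∷ Y)))

isPrimitive-lift : ∀ {X} → IsDyck X → isPrimitive (lift X) ≡ true
isPrimitive-lift {X} d with proj₂ (splitComp (lift X))
                          | cong proj₂ (trans (cong splitComp (sym (++-identityʳ (lift X))))
                                              (splitComp-lift d []))
... | []    | _  = refl
... | _ ∷ _ | ()

inner-lift : ∀ X → inner (lift X) ≡ X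
inner-lift X rewrite reverse-++ X (D ∷ []) = reverse-involutive X

EmptyOrEndsWithDD : Path → Set
EmptyOrEndsWithDD Q = Q ≡ [] ⊎ ∃ λ R → Q ≡ R ++ D ∷ D ∷ []

stripRev-reverse-emptyOrDD : ∀ {Q} → EmptyOrEndsWithDD Q →
  stripRev (reverse Q) ≡ (0 , reverse Q)
stripRev-reverse-emptyOrDD (inj₁ refl)       = refl
stripRev-reverse-emptyOrDD (inj₂ (R , refl)) = trans (cong stripRev revDD) (cong (0 ,_) (sym revDD))
  where revDD = reverse-++ R (D ∷ D ∷ [])

stripUD-++-peaks : ∀ {Q} i → EmptyOrEndsWithDD Q → stripUD (Q ++ peaks i) ≡ (i , Q)
stripUD-++-peaks {Q} i emptyOrDD =
  trans (cong (λ p → proj₁ p , reverse (proj₂ p)) (stripRev-peaks i))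
        (cong (i ,_) (reverse-involutive Q))
  where
  stripRev-peaks : ∀ i → stripRev (reverse (Q ++ peaks i)) ≡ (i , reverse Q)
  stripRev-peaks zero    =
    trans (cong (stripRev ∘ reverse) (++-identityʳ Q)) (stripRev-reverse-emptyOrDD emptyOrDD)
  stripRev-peaks (suc i) = begin
      stripRev (reverse (Q ++ peaks (suc i)))
    ≡⟨ cong (stripRev ∘ reverse) (trans (cong (Q ++_) (peaks-suc-∷ʳ i))
                                        (sym (++-assoc Q (peaks i) (U ∷ D ∷ [])))) ⟩
      stripRev (reverse ((Q ++ peaks i) ++ U ∷ D ∷ []))
    ≡⟨ cong stripRev (reverse-++ (Q ++ peaks i) (U ∷ D ∷ [])) ⟩
      stripRev (D ∷ U ∷ reverse (Q ++ peaks i))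
    ≡⟨ cong (λ p → suc (proj₁ p) , proj₂ p) (stripRev-peaks i) ⟩
      (suc i , reverse Q) ∎

module _ (F′ : Path → Path) (P : Path) {i Q} (split : stripUD (inner P) ≡ (i , Q)) where

  -- Fprim with its `with` abstraction as a function, so that split can be used under it.
  private
    Fprim-cases : ℕ × Path → Path
    Fprim-cases (k , Q′) =
      if isPrimitive Q′
      then replicate (suc k) U ++ F′ (inner Q′) ++ U ∷ D ∷ replicate (suc k) D
      else replicate (suc k) U ++ F′ Q′ ++ replicate (suc k) D

  Fprim-nonprimitive : isPrimitive Q ≡ false →
    Fprim F′ P ≡ replicate (suc i) U ++ F′ Q ++ replicate (suc i) D
  Fprim-nonprimitive nonprim with isPrimitive Q | nonprim | cong Fprim-cases split
  ... | .false | refl | unfolded = unfolded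

  Fprim-primitive : isPrimitive Q ≡ true →
    Fprim F′ P ≡ replicate (suc i) U ++ F′ (inner Q) ++ U ∷ D ∷ replicate (suc i) D
  Fprim-primitive prim with isPrimitive Q | prim | cong Fprim-cases split
  ... | .true | refl | unfolded = unfolded

Ffuel-[] : ∀ n → Ffuel n [] ≡ []
Ffuel-[] zero    = refl
Ffuel-[] (suc n) = refl

Fprim-UD : ∀ n → Fprim (Ffuel n) (U ∷ D ∷ []) ≡ U ∷ D ∷ []
Fprim-UD n = cong (λ P → U ∷ P ++ D ∷ []) (Ffuel-[] n)

Ffuel-peaks : ∀ m n → length (peaks m) ≤ n → Ffuel n (peaks m) ≡ peaks m
Ffuel-peaks zero    n       _           = Ffuel-[] n
Ffuel-peaks (suc m) (suc n) (s≤s bound) = cong₂ _++_ (Fprim-UD n) (Ffuel-peaks m n (<⇒≤ bound))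

Ffuel-lift-++ : ∀ n {X} → IsDyck X → ∀ Y →
  Ffuel (suc n) (lift X ++ Y) ≡ Fprim (Ffuel n) (lift X) ++ Ffuel n Y
Ffuel-lift-++ n d Y =
  cong (λ p → Fprim (Ffuel n) (proj₁ p) ++ Ffuel n (proj₂ p)) (splitComp-lift d Y)

lift-nest : ∀ k X → lift (nest k X) ≡ nest (suc k) X
lift-nest k X = cong (U ∷_) (begin
    (replicate k U ++ X ++ replicate k D) ++ D ∷ []
  ≡⟨ ++-assoc (replicate k U) _ _ ⟩
    replicate k U ++ (X ++ replicate k D) ++ D ∷ []
  ≡⟨ cong (replicate k U ++_) (++-assoc X (replicate k D) _) ⟩
    replicate k U ++ X ++ replicate k D ∷ʳ D
  ≡⟨ cong (λ Ds → replicate k U ++ X ++ Ds) (replicate-∷ʳ k D) ⟩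
    replicate k U ++ X ++ D ∷ replicate k D ∎)

lift-pathʳ-replicate : ∀ k ms → lift (pathʳ (replicate k 0 ++ ms)) ≡ nest (suc k) (pathʳ ms)
lift-pathʳ-replicate zero    ms = refl
lift-pathʳ-replicate (suc k) ms = begin
    lift (lift (pathʳ (replicate k 0 ++ ms)) ++ [])
  ≡⟨ cong lift (++-identityʳ (lift (pathʳ (replicate k 0 ++ ms)))) ⟩
    lift (lift (pathʳ (replicate k 0 ++ ms)))
  ≡⟨ cong lift (lift-pathʳ-replicate k ms) ⟩
    lift (nest (suc k) (pathʳ ms))
  ≡⟨ lift-nest (suc k) (pathʳ ms) ⟩
    nest (suc (suc k)) (pathʳ ms) ∎

++-peaks-++-UD : ∀ X m Z → (X ++ peaks m) ++ U ∷ D ∷ Z ≡ (X ++ peaks (suc m)) ++ Z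
++-peaks-++-UD X m Z = begin
    (X ++ peaks m) ++ U ∷ D ∷ Z
  ≡⟨ ++-assoc X (peaks m) _ ⟩
    X ++ peaks m ++ (U ∷ D ∷ []) ++ Z
  ≡⟨ cong (X ++_) (sym (++-assoc (peaks m) (U ∷ D ∷ []) Z)) ⟩
    X ++ (peaks m ++ U ∷ D ∷ []) ++ Z
  ≡⟨ cong (λ Ps → X ++ Ps ++ Z) (sym (peaks-suc-∷ʳ m)) ⟩
    X ++ peaks (suc m) ++ Z
  ≡⟨ sym (++-assoc X (peaks (suc m)) Z) ⟩
    (X ++ peaks (suc m)) ++ Z ∎

pathʳ-∷-endsWithD : ∀ m ms → ∃ λ R → pathʳ (m ∷ ms) ≡ R ∷ʳ D
pathʳ-∷-endsWithD zero    ms = U ∷ pathʳ ms , ++-identityʳ _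
pathʳ-∷-endsWithD (suc m) ms = pathʳ (m ∷ ms) ∷ʳ U , (begin
    lift (pathʳ ms) ++ peaks (suc m)
  ≡⟨ cong (lift (pathʳ ms) ++_) (peaks-suc-∷ʳ m) ⟩
    lift (pathʳ ms) ++ peaks m ++ U ∷ D ∷ []
  ≡⟨ sym (++-assoc (lift (pathʳ ms)) (peaks m) _) ⟩
    pathʳ (m ∷ ms) ++ U ∷ D ∷ []
  ≡⟨ sym (∷ʳ-++ (pathʳ (m ∷ ms)) U (D ∷ [])) ⟩
    pathʳ (m ∷ ms) ∷ʳ U ∷ʳ D ∎)

lift-pathʳ-∷-endsWithDD : ∀ m ms → ∃ λ R → lift (pathʳ (m ∷ ms)) ≡ R ++ D ∷ D ∷ []
lift-pathʳ-∷-endsWithDD m ms with pathʳ-∷-endsWithD m ms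
... | R , eq = U ∷ R , cong (U ∷_) (trans (cong (_∷ʳ D) eq) (∷ʳ-++ R D (D ∷ [])))

pathʳ-shorter : ∀ m ms → length (pathʳ ms) < length (pathʳ (m ∷ ms))
pathʳ-shorter m ms =
  s≤s (≤-trans (length-++-≤ˡ (pathʳ ms)) (length-++-≤ˡ (pathʳ ms ++ D ∷ []) {peaks m}))

peaks-shorter : ∀ m ms → length (peaks m) < length (pathʳ (m ∷ ms))
peaks-shorter m ms = s≤s (length-++-≤ʳ (peaks m) {pathʳ ms ++ D ∷ []})

-- trOdd 0 and trEven, on the entries decreased by one.
trOdd⁻ trEven⁻ : List ℕ → List ℕ
trOdd⁻ []       = []
trOdd⁻ (m ∷ ms) = m ∷ trEven⁻ ms

trEven⁻ []            = []
trEven⁻ (m ∷ [])      = replicate (suc m) 0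
trEven⁻ (m ∷ m′ ∷ ms) = replicate m 0 ++ suc m′ ∷ trEven⁻ ms

map-suc-trEven⁻ : ∀ ms → map suc (trEven⁻ ms) ≡ trEven (map suc ms)
map-suc-trEven⁻ []            = refl
map-suc-trEven⁻ (m ∷ [])      = trans (map-replicate suc (suc m) 0) (sym (replicate-∷ʳ m 1))
map-suc-trEven⁻ (m ∷ m′ ∷ ms) = trans (map-++ suc (replicate m 0) _)
  (cong₂ _++_ (map-replicate suc m 0) (cong (suc (suc m′) ∷_) (map-suc-trEven⁻ ms)))

map-suc-trOdd⁻ : ∀ ms → map suc (trOdd⁻ ms) ≡ trOdd 0 (map suc ms)
map-suc-trOdd⁻ []       = refl
map-suc-trOdd⁻ (m ∷ ms) = cong (suc m ∷_) (map-suc-trEven⁻ ms)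

mutual
  Ffuel-pathʳ : ∀ ms n → length (pathʳ ms) ≤ n → Ffuel n (pathʳ ms) ≡ pathʳ (trOdd⁻ ms)
  Ffuel-pathʳ []       n       _     = Ffuel-[] n
  Ffuel-pathʳ (m ∷ ms) (suc n) bound = begin
      Ffuel (suc n) (lift (pathʳ ms) ++ peaks m)
    ≡⟨ Ffuel-lift-++ n (pathʳ-isDyck ms) (peaks m) ⟩
      Fprim (Ffuel n) (lift (pathʳ ms)) ++ Ffuel n (peaks m)
    ≡⟨ cong₂ _++_ (Fprim-lift-pathʳ ms n (fits (pathʳ-shorter m ms)))
                  (Ffuel-peaks m n (fits (peaks-shorter m ms))) ⟩
      lift (pathʳ (trEven⁻ ms)) ++ peaks m ∎
    where
    fits : ∀ {k} → k < length (pathʳ (m ∷ ms)) → k ≤ n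
    fits k< = ≤-pred (≤-trans k< bound)

  Fprim-lift-pathʳ : ∀ ms n → length (pathʳ ms) ≤ n →
    Fprim (Ffuel n) (lift (pathʳ ms)) ≡ lift (pathʳ (trEven⁻ ms))
  Fprim-lift-pathʳ [] n _ = Fprim-UD n
  Fprim-lift-pathʳ (m ∷ []) n _ = begin
      Fprim (Ffuel n) (lift (pathʳ (m ∷ [])))
    ≡⟨ Fprim-nonprimitive (Ffuel n) (lift (pathʳ (m ∷ []))) split refl ⟩
      nest (suc (suc m)) (Ffuel n [])
    ≡⟨ cong (nest (suc (suc m))) (Ffuel-[] n) ⟩
      nest (suc (suc m)) []
    ≡⟨ sym (lift-pathʳ-replicate (suc m) []) ⟩
      lift (pathʳ (replicate (suc m) 0 ++ []))
    ≡⟨ cong (lift ∘ pathʳ) (++-identityʳ (replicate (suc m) 0)) ⟩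
      lift (pathʳ (replicate (suc m) 0)) ∎
    where
    split : stripUD (inner (lift (pathʳ (m ∷ [])))) ≡ (suc m , [])
    split = trans (cong stripUD (inner-lift (pathʳ (m ∷ []))))
                  (stripUD-++-peaks (suc m) (inj₁ refl))
  Fprim-lift-pathʳ (m ∷ m′ ∷ ms) n bound = begin
      Fprim (Ffuel n) (lift (pathʳ (m ∷ m′ ∷ ms)))
    ≡⟨ Fprim-primitive (Ffuel n) (lift (pathʳ (m ∷ m′ ∷ ms))) split
                       (isPrimitive-lift (pathʳ-isDyck (m′ ∷ ms))) ⟩
      Us ++ Ffuel n (inner (lift (pathʳ (m′ ∷ ms)))) ++ U ∷ D ∷ Ds
    ≡⟨ cong (λ X → Us ++ Ffuel n X ++ U ∷ D ∷ Ds) (inner-lift _) ⟩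
      Us ++ Ffuel n (pathʳ (m′ ∷ ms)) ++ U ∷ D ∷ Ds
    ≡⟨ cong (λ X → Us ++ X ++ U ∷ D ∷ Ds) (Ffuel-pathʳ (m′ ∷ ms) n shorter) ⟩
      Us ++ (lift (pathʳ (trEven⁻ ms)) ++ peaks m′) ++ U ∷ D ∷ Ds
    ≡⟨ cong (Us ++_) (++-peaks-++-UD (lift (pathʳ (trEven⁻ ms))) m′ Ds) ⟩
      nest (suc m) (pathʳ (suc m′ ∷ trEven⁻ ms))
    ≡⟨ sym (lift-pathʳ-replicate m (suc m′ ∷ trEven⁻ ms)) ⟩
      lift (pathʳ (replicate m 0 ++ suc m′ ∷ trEven⁻ ms)) ∎
    where
    Us = replicate (suc m) U
    Ds = replicate (suc m) D
    split : stripUD (inner (lift (pathʳ (m ∷ m′ ∷ ms)))) ≡ (m , lift (pathʳ (m′ ∷ ms)))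
    split = trans (cong stripUD (inner-lift (pathʳ (m ∷ m′ ∷ ms))))
                  (stripUD-++-peaks m (inj₂ (lift-pathʳ-∷-endsWithDD m′ ms)))
    shorter : length (pathʳ (m′ ∷ ms)) ≤ n
    shorter = ≤-trans (<⇒≤ (pathʳ-shorter m (m′ ∷ ms))) bound

F-pathʳ : ∀ ms → F (pathʳ ms) ≡ pathʳ (trOdd⁻ ms)
F-pathʳ ms = Ffuel-pathʳ ms (length (pathʳ ms)) ≤-refl

transformComposition⁻ : List ℕ → List ℕ
transformComposition⁻ c = reverse (trOdd⁻ (reverse c))

F-pathOf : ∀ c → F (pathOf c) ≡ pathOf (transformComposition⁻ c)
F-pathOf c = begin
    F (pathOf c)
  ≡⟨ cong F (pathOf≡pathʳ-reverse c) ⟩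
    F (pathʳ (reverse c))
  ≡⟨ F-pathʳ (reverse c) ⟩
    pathʳ (trOdd⁻ (reverse c))
  ≡⟨ pathʳ≡pathOf-reverse (trOdd⁻ (reverse c)) ⟩
    pathOf (transformComposition⁻ c) ∎

map-suc-transformComposition⁻ : ∀ c →
  map suc (transformComposition⁻ c) ≡ transformComposition (map suc c)
map-suc-transformComposition⁻ c = begin
    map suc (reverse (trOdd⁻ (reverse c)))
  ≡⟨ reverse-map suc (trOdd⁻ (reverse c)) ⟩
    reverse (map suc (trOdd⁻ (reverse c)))
  ≡⟨ cong reverse (map-suc-trOdd⁻ (reverse c)) ⟩
    reverse (trOdd 0 (map suc (reverse c)))
  ≡⟨ cong (reverse ∘ trOdd 0) (reverse-map suc c) ⟩
    reverse (trOdd 0 (reverse (map suc c))) ∎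

proposition1 : (P : Path) → IsDyck P → AvoidsDUU P →
    IsDyck (F P) × AvoidsDUU (F P) × (composition (F P) ≡ transformComposition (composition P))
proposition1 P dyck avoids with dyck-avoidsDUU⇒pathOf dyck avoids
... | c , refl rewrite F-pathOf c =
  pathOf-isDyck c′ , pathOf-avoidsDUU c′ , (begin
    composition (pathOf c′)
  ≡⟨ composition-pathOf c′ ⟩
    map suc c′
  ≡⟨ map-suc-transformComposition⁻ c ⟩
    transformComposition (map suc c)
  ≡⟨ cong transformComposition (sym (composition-pathOf c)) ⟩
    transformComposition (composition (pathOf c)) ∎)
  where c′ = transformComposition⁻ c
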